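{- Let $L$ be a three-dimensional lattice of width $n$, $f : L \to L$, and $s=(*,*,s_3)$ a principal slice. Then: (1) given a top-boundary down set witness $(d,b)$, there is an $O(\log n)$-query algorithm that finds a point $x$ with $d \preceq x \preceq b$ and $x_1 = f(x)_1$, or a violation of order preservation of $f$; (2) given a right-boundary down set witness $(d,b)$, there is an $O(\log n)$-query algorithm that finds a point $x$ with $d \preceq x \preceq b$ and $x_2 = f(x)_2$, or a violation of order preservation; (3) given a bottom-boundary up set witness $(a,u)$, there is an $O(\log n)$-query algorithm that finds a point $x$ with $a \preceq x \preceq u$ and $x_1 = f(x)_1$, or a violation of order preservation; (4) given a left-boundary up set witness $(a,u)$, there is an $O(\log n)$-query algorithm that finds a point $x$ with $a \preceq x \preceq u$ and $x_2 = f(x)_2$, or a violation of order preservation.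
   Context: $L = L(n_1,n_2,n_3)$ is the set of $x \in \mathbb{N}^3$ with $1 \le x_i \le n_i$, ordered componentwise by $\preceq$; $n = \max_i n_i$. A query is one evaluation of $f$. A violation of order preservation is a pair of points $x \preceq y$ with $f(x)\not\preceq f(y)$. $L_s = \{x\in L : x_3 = s_3\}$. A down set witness is a pair $(d,b)$ with $d,b\in L_s$, $d_3\le f(d)_3$, $b_3\le f(b)_3$, and $i\ne j\in\{1,2\}$ with $d_i=b_i$, $d_j\le b_j$, $d_j\le f(d)_j$, $f(b)_j\le b_j$; it is top-boundary if $d_2=b_2$ and right-boundary if $d_1=b_1$. An up set witness is a pair $(a,u)$ with $a,u\in L_s$, $a_3\ge f(a)_3$, $u_3\ge f(u)_3$, and $i\ne j\in\{1,2\}$ with $a_i=u_i$, $u_j\ge a_j$, $u_j\ge f(u)_j$, $f(a)_j\ge a_j$; it is left-boundary if $a_1=u_1$ and bottom-boundary if $a_2=u_2$. -}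

module Defs where

open import Data.Nat using (ℕ; _≤_; _*_; _+_; _⊔_; suc)
open import Data.Nat.Logarithm using (⌈log₂_⌉)
open import Data.Fin using (Fin; toℕ)
open import Data.Product using (Σ; _×_; _,_)
open import Data.Sum using (_⊎_; inj₁; inj₂)
open import Relation.Binary.PropositionalEquality using (_≡_)
open import Relation.Nullary using (¬_)

-- Coordinate i of a point ranges over Fin nᵢ,
-- i.e. over {0,…,nᵢ-1} (a shift by one of the paper's {1,…,nᵢ}; all
-- notions below only use order and equality of coordinates).
Pt : ℕ → ℕ → ℕ → Set
Pt n₁ n₂ n₃ = Fin n₁ × Fin n₂ × Fin n₃

width : ℕ → ℕ → ℕ → ℕ
width n₁ n₂ n₃ = n₁ ⊔ n₂ ⊔ n₃

module _ {n₁ n₂ n₃ : ℕ} where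

  c₁ c₂ c₃ : Pt n₁ n₂ n₃ → ℕ
  c₁ (x , _ , _) = toℕ x
  c₂ (_ , y , _) = toℕ y
  c₃ (_ , _ , z) = toℕ z

  _≼_ : Pt n₁ n₂ n₃ → Pt n₁ n₂ n₃ → Set
  x ≼ y = c₁ x ≤ c₁ y × c₂ x ≤ c₂ y × c₃ x ≤ c₃ y

  Violation : (Pt n₁ n₂ n₃ → Pt n₁ n₂ n₃) → Pt n₁ n₂ n₃ → Pt n₁ n₂ n₃ → Set
  Violation f x y = x ≼ y × ¬ (f x ≼ f y)

  InSlice : Fin n₃ → Pt n₁ n₂ n₃ → Set
  InSlice s₃ x = c₃ x ≡ toℕ s₃

  DownWitnessAlong : (ci cj : Pt n₁ n₂ n₃ → ℕ) → Fin n₃ →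
                     (Pt n₁ n₂ n₃ → Pt n₁ n₂ n₃) → Pt n₁ n₂ n₃ → Pt n₁ n₂ n₃ → Set
  DownWitnessAlong ci cj s₃ f d b =
    InSlice s₃ d × InSlice s₃ b ×
    c₃ d ≤ c₃ (f d) × c₃ b ≤ c₃ (f b) ×
    ci d ≡ ci b × cj d ≤ cj b × cj d ≤ cj (f d) × cj (f b) ≤ cj b

  UpWitnessAlong : (ci cj : Pt n₁ n₂ n₃ → ℕ) → Fin n₃ →
                   (Pt n₁ n₂ n₃ → Pt n₁ n₂ n₃) → Pt n₁ n₂ n₃ → Pt n₁ n₂ n₃ → Set
  UpWitnessAlong ci cj s₃ f a u =
    InSlice s₃ a × InSlice s₃ u ×
    c₃ (f a) ≤ c₃ a × c₃ (f u) ≤ c₃ u ×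
    ci a ≡ ci u × cj a ≤ cj u × cj (f u) ≤ cj u × cj a ≤ cj (f a)

  TopDownWitness : Fin n₃ → (Pt n₁ n₂ n₃ → Pt n₁ n₂ n₃) → Pt n₁ n₂ n₃ → Pt n₁ n₂ n₃ → Set
  TopDownWitness = DownWitnessAlong c₂ c₁

  RightDownWitness : Fin n₃ → (Pt n₁ n₂ n₃ → Pt n₁ n₂ n₃) → Pt n₁ n₂ n₃ → Pt n₁ n₂ n₃ → Set
  RightDownWitness = DownWitnessAlong c₁ c₂

  BottomUpWitness : Fin n₃ → (Pt n₁ n₂ n₃ → Pt n₁ n₂ n₃) → Pt n₁ n₂ n₃ → Pt n₁ n₂ n₃ → Set
  BottomUpWitness = UpWitnessAlong c₂ c₁

  LeftUpWitness : Fin n₃ → (Pt n₁ n₂ n₃ → Pt n₁ n₂ n₃) → Pt n₁ n₂ n₃ → Pt n₁ n₂ n₃ → Set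
  LeftUpWitness = UpWitnessAlong c₁ c₂

-- Adaptive query algorithms (decision trees): each query asks for f at a point.
data QueryAlg (P A : Set) : Set where
  done  : A → QueryAlg P A
  query : P → (P → QueryAlg P A) → QueryAlg P A

run : {P A : Set} → (P → P) → QueryAlg P A → A
run f (done a)    = a
run f (query p k) = run f (k (f p))

queries : {P A : Set} → (P → P) → QueryAlg P A → ℕ
queries f (done a)    = 0
queries f (query p k) = suc (queries f (k (f p)))

Out : ℕ → ℕ → ℕ → Set
Out n₁ n₂ n₃ = Pt n₁ n₂ n₃ ⊎ (Pt n₁ n₂ n₃ × Pt n₁ n₂ n₃)

Valid : {n₁ n₂ n₃ : ℕ} → (Pt n₁ n₂ n₃ → Pt n₁ n₂ n₃) →
        (Pt n₁ n₂ n₃ → Set) → Out n₁ n₂ n₃ → Set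
Valid f G (inj₁ x)       = G x
Valid f G (inj₂ (x , y)) = Violation f x y

-- "Given a witness W, there is an O(log n)-query algorithm finding a point x
-- with p ⪯ x ⪯ q and coordinate cj x = cj (f x), or a violation":
-- a single constant c such that for every lattice, slice and input pair
-- (p , q) there is an algorithm that, on every f for which (p , q) is a
-- witness, makes at most c · (⌈log₂ n⌉ + 1) queries and returns a valid answer.
LogQuerySolvable :
  (W : ∀ {n₁ n₂ n₃} → Fin n₃ → (Pt n₁ n₂ n₃ → Pt n₁ n₂ n₃) → Pt n₁ n₂ n₃ → Pt n₁ n₂ n₃ → Set)
  (cj : ∀ {n₁ n₂ n₃} → Pt n₁ n₂ n₃ → ℕ) → Set
LogQuerySolvable W cj =
  Σ ℕ λ c → ∀ n₁ n₂ n₃ (s₃ : Fin n₃) (p q : Pt n₁ n₂ n₃) →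
    Σ (QueryAlg (Pt n₁ n₂ n₃) (Out n₁ n₂ n₃)) λ A →
      ∀ (f : Pt n₁ n₂ n₃ → Pt n₁ n₂ n₃) → W s₃ f p q →
        queries f A ≤ c * (⌈log₂ width n₁ n₂ n₃ ⌉ + 1) ×
        Valid f (λ x → p ≼ x × x ≼ q × cj x ≡ cj (f x)) (run f A)

-- Restricted to the segment from p to q along coordinate j, f points inward
-- at both ends: p_j ≤ f(p)_j and f(q)_j ≤ q_j.  Binary search keeps a bracket
-- lo ≤ hi with lo ≤ f(lo)_j and f(hi)_j ≤ hi, halving it with one query per
-- step; after ⌈log₂ n⌉ steps hi ≤ lo + 1.  Then either an endpoint is fixed in
-- coordinate j, or f(lo)_j > lo ≥ hi - 1 ≥ f(hi)_j although lo ⪯ hi, which is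
-- a violation of order preservation.
module Submission where

open import Defs
open import Data.Product using (_×_; _,_; proj₁; proj₂)
open import Data.Sum using (inj₁; inj₂)
open import Data.Nat
  using (ℕ; zero; suc; _+_; _*_; _^_; _∸_; _≤_; _<_; z≤n; s≤s; _≟_; _≤?_; _<?_; ⌈_/2⌉; ⌊_/2⌋)
open import Data.Nat.Properties
open import Data.Nat.Logarithm using (⌈log₂_⌉; ⌈log₂⌉-mono-≤; ⌈log₂⌈n/2⌉⌉≡⌈log₂n⌉∸1; ⌈log₂2^n⌉≡n)
open import Data.Nat.Induction using (<-rec)
open import Data.Fin using (Fin; toℕ; fromℕ<)
open import Data.Fin.Properties using (toℕ-fromℕ<; toℕ<n; toℕ-injective)
open import Relation.Binary.PropositionalEquality
open import Relation.Nullary using (yes; no)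
open import Relation.Nullary.Negation using (contradiction)

n≤2^⌈log₂n⌉ : ∀ n → n ≤ 2 ^ ⌈log₂ n ⌉
n≤2^⌈log₂n⌉ = <-rec (λ n → n ≤ 2 ^ ⌈log₂ n ⌉) step
  where
  step : ∀ n → (∀ {m} → m < n → m ≤ 2 ^ ⌈log₂ m ⌉) → n ≤ 2 ^ ⌈log₂ n ⌉
  step zero          _   = z≤n
  step (suc zero)    _   = m^n>0 2 ⌈log₂ 1 ⌉
  step n@(suc (suc m)) rec = begin
    n                          ≡⟨ ⌊n/2⌋+⌈n/2⌉≡n n ⟨
    ⌊ n /2⌋ + ⌈ n /2⌉          ≤⟨ +-monoˡ-≤ ⌈ n /2⌉ (⌊n/2⌋≤⌈n/2⌉ n) ⟩
    ⌈ n /2⌉ + ⌈ n /2⌉          ≤⟨ +-mono-≤ half≤ half≤ ⟩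
    2 ^ (L ∸ 1) + 2 ^ (L ∸ 1)  ≡⟨ cong (2 ^ (L ∸ 1) +_) (+-identityʳ _) ⟨
    2 ^ (1 + (L ∸ 1))          ≡⟨ cong (2 ^_) (m+[n∸m]≡n 1≤L) ⟩
    2 ^ L                      ∎
    where
    open ≤-Reasoning
    L : ℕ
    L = ⌈log₂ n ⌉
    1≤L : 1 ≤ L
    1≤L = subst (_≤ L) (⌈log₂2^n⌉≡n 1) (⌈log₂⌉-mono-≤ {2 ^ 1} {n} (s≤s (s≤s z≤n)))
    half≤ : ⌈ n /2⌉ ≤ 2 ^ (L ∸ 1)
    half≤ = subst (λ e → ⌈ n /2⌉ ≤ 2 ^ e) (⌈log₂⌈n/2⌉⌉≡⌈log₂n⌉∸1 n) (rec {⌈ n /2⌉} (⌈n/2⌉<n m))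

n+2≤2*[n+1] : ∀ n → n + 2 ≤ 2 * (n + 1)
n+2≤2*[n+1] n = begin
  n + 2             ≡⟨ +-assoc n 1 1 ⟨
  (n + 1) + 1       ≤⟨ +-monoʳ-≤ (n + 1) (m≤n+m 1 n) ⟩
  (n + 1) + (n + 1) ≡⟨ cong ((n + 1) +_) (+-identityʳ (n + 1)) ⟨
  2 * (n + 1)       ∎
  where open ≤-Reasoning

fromℕ-or : ∀ {n} → Fin n → ℕ → Fin n
fromℕ-or {n} i k with k <? n
... | yes k<n = fromℕ< k<n
... | no _    = i

toℕ-fromℕ-or : ∀ {n} (i : Fin n) {k} → k < n → toℕ (fromℕ-or i k) ≡ k
toℕ-fromℕ-or {n} i {k} k<n with k <? n
... | yes k<n′ = toℕ-fromℕ< k<n′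
... | no  k≮n  = contradiction k<n k≮n

fromℕ-or-toℕ : ∀ {n} (i j : Fin n) → fromℕ-or i (toℕ j) ≡ j
fromℕ-or-toℕ i j = toℕ-injective (toℕ-fromℕ-or i (toℕ<n j))

Coord : Set
Coord = ∀ {n₁ n₂ n₃} → Pt n₁ n₂ n₃ → ℕ

-- Lines through a point along coordinate j, keeping cᵢ and c₃ fixed.
record Direction (ci cj : Coord) : Set where
  field
    along      : ∀ {n₁ n₂ n₃} → Pt n₁ n₂ n₃ → ℕ → Pt n₁ n₂ n₃
    cj-mono    : ∀ {n₁ n₂ n₃} {x y : Pt n₁ n₂ n₃} → x ≼ y → cj x ≤ cj y
    cj<width   : ∀ {n₁ n₂ n₃} (x : Pt n₁ n₂ n₃) → cj x < width n₁ n₂ n₃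
    cj-along   : ∀ {n₁ n₂ n₃} (p q : Pt n₁ n₂ n₃) {k} → k ≤ cj q → cj (along p k) ≡ k
    along-mono : ∀ {n₁ n₂ n₃} (p q : Pt n₁ n₂ n₃) {k k′} → k ≤ k′ → k′ ≤ cj q →
                 along p k ≼ along p k′
    along-hits : ∀ {n₁ n₂ n₃} {p q : Pt n₁ n₂ n₃} → ci p ≡ ci q → c₃ p ≡ c₃ q →
                 along p (cj q) ≡ q

direction₁ : Direction c₂ c₁
direction₁ = record
  { along      = along
  ; cj-mono    = proj₁
  ; cj<width   = λ { {n₁} {n₂} {n₃} (x , _) → <-≤-trans (toℕ<n x) (≤-trans (m≤m⊔n n₁ n₂) (m≤m⊔n _ n₃)) }
  ; cj-along   = cj-along
  ; along-mono = λ p q k≤k′ k′≤q →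
      subst₂ _≤_ (sym (cj-along p q (≤-trans k≤k′ k′≤q))) (sym (cj-along p q k′≤q)) k≤k′ , ≤-refl , ≤-refl
  ; along-hits = λ { {p = x , _} {q = x′ , _} e₂ e₃ →
      cong₂ _,_ (fromℕ-or-toℕ x x′) (cong₂ _,_ (toℕ-injective e₂) (toℕ-injective e₃)) }
  }
  where
  along : ∀ {n₁ n₂ n₃} → Pt n₁ n₂ n₃ → ℕ → Pt n₁ n₂ n₃
  along (x , yz) k = fromℕ-or x k , yz
  cj-along : ∀ {n₁ n₂ n₃} (p q : Pt n₁ n₂ n₃) {k} → k ≤ c₁ q → c₁ (along p k) ≡ k
  cj-along (x , _) (x′ , _) k≤x′ = toℕ-fromℕ-or x (≤-<-trans k≤x′ (toℕ<n x′))

direction₂ : Direction c₁ c₂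
direction₂ = record
  { along      = along
  ; cj-mono    = λ x≼y → proj₁ (proj₂ x≼y)
  ; cj<width   = λ { {n₁} {n₂} {n₃} (_ , y , _) → <-≤-trans (toℕ<n y) (≤-trans (m≤n⊔m n₁ n₂) (m≤m⊔n _ n₃)) }
  ; cj-along   = cj-along
  ; along-mono = λ p q k≤k′ k′≤q →
      ≤-refl , subst₂ _≤_ (sym (cj-along p q (≤-trans k≤k′ k′≤q))) (sym (cj-along p q k′≤q)) k≤k′ , ≤-refl
  ; along-hits = λ { {p = _ , y , _} {q = _ , y′ , _} e₁ e₃ →
      cong₂ _,_ (toℕ-injective e₁) (cong₂ _,_ (fromℕ-or-toℕ y y′) (toℕ-injective e₃)) }
  }
  where
  along : ∀ {n₁ n₂ n₃} → Pt n₁ n₂ n₃ → ℕ → Pt n₁ n₂ n₃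
  along (x , y , z) k = x , fromℕ-or y k , z
  cj-along : ∀ {n₁ n₂ n₃} (p q : Pt n₁ n₂ n₃) {k} → k ≤ c₂ q → c₂ (along p k) ≡ k
  cj-along (_ , y , _) (_ , y′ , _) k≤y′ = toℕ-fromℕ-or y (≤-<-trans k≤y′ (toℕ<n y′))

record InwardSegment (ci cj : Coord) {n₁ n₂ n₃ : ℕ}
                     (f : Pt n₁ n₂ n₃ → Pt n₁ n₂ n₃) (p q : Pt n₁ n₂ n₃) : Set where
  constructor inward-segment
  field
    ci-equal    : ci p ≡ ci q
    c₃-equal    : c₃ p ≡ c₃ q
    cj-≤        : cj p ≤ cj q
    inward-at-p : cj p ≤ cj (f p)
    inward-at-q : cj (f q) ≤ cj q

down-inward : ∀ {ci cj : Coord} {n₁ n₂ n₃} {s₃ : Fin n₃} {f} {d b : Pt n₁ n₂ n₃} →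
              DownWitnessAlong ci cj s₃ f d b → InwardSegment ci cj f d b
down-inward (d∈s , b∈s , _ , _ , dᵢ≡bᵢ , dⱼ≤bⱼ , d-in , b-in) =
  inward-segment dᵢ≡bᵢ (trans d∈s (sym b∈s)) dⱼ≤bⱼ d-in b-in

up-inward : ∀ {ci cj : Coord} {n₁ n₂ n₃} {s₃ : Fin n₃} {f} {a u : Pt n₁ n₂ n₃} →
            UpWitnessAlong ci cj s₃ f a u → InwardSegment ci cj f a u
up-inward (a∈s , u∈s , _ , _ , aᵢ≡uᵢ , aⱼ≤uⱼ , u-in , a-in) =
  inward-segment aᵢ≡uᵢ (trans a∈s (sym u∈s)) aⱼ≤uⱼ a-in u-in

module SegmentSearch {ci cj : Coord} (dir : Direction ci cj)
                     {n₁ n₂ n₃ : ℕ} (p q : Pt n₁ n₂ n₃) where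

  open Direction dir

  P : Set
  P = Pt n₁ n₂ n₃

  answer : ℕ → ℕ → P → P → Out n₁ n₂ n₃
  answer lo hi flo fhi with cj (along p lo) ≟ cj flo | cj (along p hi) ≟ cj fhi
  ... | yes _ | _     = inj₁ (along p lo)
  ... | no _  | yes _ = inj₁ (along p hi)
  ... | no _  | no _  = inj₂ (along p lo , along p hi)

  -- search k lo hi assumes hi ≤ lo + 2 ^ k.
  search : ℕ → ℕ → ℕ → QueryAlg P (Out n₁ n₂ n₃)
  narrow : ℕ → ℕ → ℕ → P → QueryAlg P (Out n₁ n₂ n₃)

  search zero lo hi =
    query (along p lo) λ flo → query (along p hi) λ fhi → done (answer lo hi flo fhi)
  search (suc k) lo hi with lo + 2 ^ k <? hi
  ... | yes _ = query (along p (lo + 2 ^ k)) (narrow k lo hi)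
  ... | no _  = search k lo hi

  narrow k lo hi fmid with lo + 2 ^ k ≤? cj fmid
  ... | yes _ = search k (lo + 2 ^ k) hi
  ... | no _  = search k lo (lo + 2 ^ k)

  search-queries : ∀ f k lo hi → queries f (search k lo hi) ≤ k + 2
  search-queries f zero    lo hi = ≤-refl
  search-queries f (suc k) lo hi with lo + 2 ^ k <? hi
  ... | no _ = m≤n⇒m≤1+n (search-queries f k lo hi)
  ... | yes _ with lo + 2 ^ k ≤? cj (f (along p (lo + 2 ^ k)))
  ...   | yes _ = s≤s (search-queries f k (lo + 2 ^ k) hi)
  ...   | no _  = s≤s (search-queries f k lo (lo + 2 ^ k))

  module _ (f : P → P) (inward : InwardSegment ci cj f p q) where

    open InwardSegment inward

    Goal : P → Set
    Goal x = p ≼ x × x ≼ q × cj x ≡ cj (f x)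

    g : ℕ → ℕ
    g k = cj (f (along p k))

    record Bracket (lo hi : ℕ) : Set where
      constructor bracket
      field
        p≤lo   : cj p ≤ lo
        lo≤hi  : lo ≤ hi
        hi≤q   : hi ≤ cj q
        lo≤glo : lo ≤ g lo
        ghi≤hi : g hi ≤ hi

    initial-bracket : Bracket (cj p) (cj q)
    initial-bracket = bracket ≤-refl cj-≤ ≤-refl
      (subst (λ x → cj p ≤ cj (f x)) (sym (along-hits refl refl)) inward-at-p)
      (subst (λ x → cj (f x) ≤ cj q) (sym (along-hits ci-equal c₃-equal)) inward-at-q)

    fixed-on-segment : ∀ {k} → cj p ≤ k → k ≤ cj q → cj (along p k) ≡ g k → Goal (along p k)
    fixed-on-segment {k} p≤k k≤q fixed =
      subst (_≼ along p k) (along-hits refl refl) (along-mono p q p≤k k≤q) ,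
      subst (along p k ≼_) (along-hits ci-equal c₃-equal) (along-mono p q k≤q ≤-refl) ,
      fixed

    crossing-violation : ∀ {lo hi} → Bracket lo hi → hi ≤ suc lo →
                         cj (along p lo) ≢ g lo → cj (along p hi) ≢ g hi →
                         Violation f (along p lo) (along p hi)
    crossing-violation {lo} {hi} (bracket _ lo≤hi hi≤q lo≤glo ghi≤hi) hi≤1+lo lo-moves hi-moves =
      along-mono p q lo≤hi hi≤q , λ flo≼fhi → <⇒≱ ghi<glo (cj-mono flo≼fhi)
      where
      lo<glo : lo < g lo
      lo<glo = ≤∧≢⇒< lo≤glo λ e → lo-moves (trans (cj-along p q (≤-trans lo≤hi hi≤q)) e)
      ghi<hi : g hi < hi
      ghi<hi = ≤∧≢⇒< ghi≤hi λ e → hi-moves (trans (cj-along p q hi≤q) (sym e))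
      ghi<glo : g hi < g lo
      ghi<glo = <-≤-trans ghi<hi (≤-trans hi≤1+lo lo<glo)

    adjacent-valid : ∀ {lo hi} → Bracket lo hi → hi ≤ suc lo → Valid f Goal (run f (search 0 lo hi))
    adjacent-valid {lo} {hi} b@(bracket p≤lo lo≤hi hi≤q _ _) hi≤1+lo
      with cj (along p lo) ≟ g lo | cj (along p hi) ≟ g hi
    ... | yes fixed   | _           = fixed-on-segment p≤lo (≤-trans lo≤hi hi≤q) fixed
    ... | no _        | yes fixed   = fixed-on-segment (≤-trans p≤lo lo≤hi) hi≤q fixed
    ... | no lo-moves | no hi-moves = crossing-violation b hi≤1+lo lo-moves hi-moves

    search-valid : ∀ k {lo hi} → Bracket lo hi → hi ≤ lo + 2 ^ k → Valid f Goal (run f (search k lo hi))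
    search-valid zero    {lo} {hi} b hi≤ = adjacent-valid b (subst (hi ≤_) (+-comm lo 1) hi≤)
    search-valid (suc k) {lo} {hi} b@(bracket p≤lo lo≤hi hi≤q lo≤glo ghi≤hi) hi≤
      with lo + 2 ^ k <? hi
    ... | no mid≮hi = search-valid k b (≮⇒≥ mid≮hi)
    ... | yes mid<hi with lo + 2 ^ k ≤? g (lo + 2 ^ k)
    ...   | yes mid≤gmid = search-valid k
              (bracket (≤-trans p≤lo (m≤m+n lo _)) (<⇒≤ mid<hi) hi≤q mid≤gmid ghi≤hi)
              (subst (hi ≤_) upper-half hi≤)
      where
      upper-half : lo + 2 ^ suc k ≡ lo + 2 ^ k + 2 ^ k
      upper-half = begin
        lo + (2 ^ k + (2 ^ k + 0)) ≡⟨ cong (λ x → lo + (2 ^ k + x)) (+-identityʳ (2 ^ k)) ⟩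
        lo + (2 ^ k + 2 ^ k)       ≡⟨ +-assoc lo _ _ ⟨
        lo + 2 ^ k + 2 ^ k         ∎
        where open ≡-Reasoning
    ...   | no mid≰gmid = search-valid k
              (bracket p≤lo (m≤m+n lo _) (≤-trans (<⇒≤ mid<hi) hi≤q) lo≤glo (<⇒≤ (≰⇒> mid≰gmid)))
              ≤-refl

inward-log-solvable :
  ∀ {ci cj : Coord} → Direction ci cj →
  (W : ∀ {n₁ n₂ n₃} → Fin n₃ → (Pt n₁ n₂ n₃ → Pt n₁ n₂ n₃) → Pt n₁ n₂ n₃ → Pt n₁ n₂ n₃ → Set) →
  (∀ {n₁ n₂ n₃} {s₃ : Fin n₃} {f} {p q : Pt n₁ n₂ n₃} → W s₃ f p q → InwardSegment ci cj f p q) →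
  LogQuerySolvable W cj
inward-log-solvable {cj = cj} dir W inward = 2 , λ n₁ n₂ n₃ s₃ p q →
  let open SegmentSearch dir p q
      K : ℕ
      K = ⌈log₂ width n₁ n₂ n₃ ⌉
      qⱼ≤pⱼ+2^K : cj q ≤ cj p + 2 ^ K
      qⱼ≤pⱼ+2^K = ≤-trans (<⇒≤ (<-≤-trans (Direction.cj<width dir q) (n≤2^⌈log₂n⌉ _)))
                          (m≤n+m _ (cj p))
  in search K (cj p) (cj q) , λ f w →
       ≤-trans (search-queries f K (cj p) (cj q)) (n+2≤2*[n+1] K) ,
       search-valid f (inward w) K (initial-bracket f (inward w)) qⱼ≤pⱼ+2^K

lemma20 : LogQuerySolvable TopDownWitness c₁
        × LogQuerySolvable RightDownWitness c₂
        × LogQuerySolvable BottomUpWitness c₁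
        × LogQuerySolvable LeftUpWitness c₂
lemma20 = inward-log-solvable direction₁ TopDownWitness   down-inward
        , inward-log-solvable direction₂ RightDownWitness down-inward
        , inward-log-solvable direction₁ BottomUpWitness  up-inward
        , inward-log-solvable direction₂ LeftUpWitness    up-inward
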